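{- Let $m \geq 2$ and $k \geq 2$ be integers. Suppose an edge-coloring of $K_n$ with (at most) $k$ colors has no rainbow triangle, no monochromatic copy of $B_m$, admits a Gallai-partition in which every part has at most $m-1$ vertices, and has exactly one $m$-admissible color. Then $$ n \leq \begin{cases} 3m - 1 & \text{if } k = 2,\\ 5m - 5 & \text{otherwise.}\end{cases} $$
   Context: $B_m = K_2 + \overline{K_m}$ is the book with $m$ pages: an edge $uv$ together with $m$ further vertices each adjacent to both $u$ and $v$. A triangle is rainbow if its three edges have distinct colors. A Gallai-partition of an edge-colored complete graph is a partition of the vertex set into at least two parts such that, for each pair of distinct parts, all edges between them receive a single color, and in total at most two colors appear on edges between parts. A color is called $m$-admissible if the spanning subgraph formed by the edges of that color has maximum degree at least $m$, and $m$-inadmissible otherwise. -}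

module Defs where

open import Data.Nat using (ℕ; zero; suc; _+_; _*_; _≤_; _∸_)
open import Data.Fin using (Fin; zero; suc)
open import Data.Fin.Properties using (_≟_)
open import Data.Product using (Σ; _×_; _,_; ∃)
open import Data.Sum using (_⊎_)
open import Relation.Nullary using (¬_; Dec; yes; no)
open import Relation.Binary.PropositionalEquality using (_≡_; _≢_)
open import Function.Definitions using (Injective)

-- An edge-colouring of K_n with colours from Fin k: a function on ordered
-- pairs of vertices which is symmetric on distinct pairs (diagonal values
-- are irrelevant and never used).
record Colouring (n k : ℕ) : Set where
  field
    col : Fin n → Fin n → Fin k
    sym : ∀ {i j} → i ≢ j → col i j ≡ col j i
open Colouring public

count : ∀ {n} (P : Fin n → Set) → (∀ x → Dec (P x)) → ℕ
count {zero} P P? = 0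
count {suc n} P P? with P? zero
... | yes _ = suc (count (λ x → P (suc x)) (λ x → P? (suc x)))
... | no _ = count (λ x → P (suc x)) (λ x → P? (suc x))

module _ {n k : ℕ} (c : Colouring n k) where

  RainbowTriangle : Set
  RainbowTriangle = Σ (Fin n) λ x → Σ (Fin n) λ y → Σ (Fin n) λ z →
    (x ≢ y) × (y ≢ z) × (x ≢ z) ×
    (col c x y ≢ col c y z) × (col c y z ≢ col c x z) × (col c x y ≢ col c x z)

  -- a monochromatic copy of the book B_m: spine uv plus m distinct pages
  -- w_1..w_m (distinct from u,v), every edge of the book having colour a
  MonoBook : ℕ → Set
  MonoBook m = Σ (Fin k) λ a → Σ (Fin n) λ u → Σ (Fin n) λ v →
    Σ (Fin m → Fin n) λ w →
    (u ≢ v) × Injective _≡_ _≡_ w ×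
    (∀ t → w t ≢ u) × (∀ t → w t ≢ v) ×
    (col c u v ≡ a) × (∀ t → col c u (w t) ≡ a) × (∀ t → col c v (w t) ≡ a)

  record GallaiPartition : Set where
    field
      p        : ℕ
      part     : Fin n → Fin p
      atLeast2 : 2 ≤ p
      nonempty : ∀ q → ∃ λ x → part x ≡ q
      uniform  : ∀ x y x' y' → part x ≢ part y →
                 part x ≡ part x' → part y ≡ part y' → col c x y ≡ col c x' y'
      colA     : Fin k
      colB     : Fin k
      twoCols  : ∀ x y → part x ≢ part y → (col c x y ≡ colA) ⊎ (col c x y ≡ colB)

  PartsAtMost : GallaiPartition → ℕ → Set
  PartsAtMost P s = ∀ q → count (λ x → GallaiPartition.part P x ≡ q)
                                   (λ x → GallaiPartition.part P x ≟ q) ≤ s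

  colDeg : Fin k → Fin n → ℕ
  colDeg a v = count (λ y → (v ≢ y) × (col c v y ≡ a)) dec
    where
      dec : ∀ y → Dec ((v ≢ y) × (col c v y ≡ a))
      dec y with v ≟ y | col c v y ≟ a
      ... | yes e | _ = no (λ { (ne , _) → ne e })
      ... | no ne | yes e = yes (ne , e)
      ... | no ne | no f = no (λ { (_ , e) → f e })

  Admissible : ℕ → Fin k → Set
  Admissible m a = Σ (Fin n) λ v → m ≤ colDeg a v

  ExactlyOneAdmissible : ℕ → Set
  ExactlyOneAdmissible m = Σ (Fin k) λ a → Admissible m a × (∀ b → Admissible m b → b ≡ a)

bound : ℕ → ℕ → ℕ
bound 2 m = 3 * m ∸ 1
bound _ m = 5 * m ∸ 5

module Submission where

-- Write m = m' + 1, let a be the unique m-admissible colour and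
-- xy an a-coloured edge at a vertex of a-degree ≥ m.  Every other colour is
-- m-inadmissible, so each vertex has at most m' neighbours in it, and since
-- there is no monochromatic B_m the edge xy has at most m' common
-- a-neighbours.  Hence the vertices z ∉ {x, y} seeing x and y only in the
-- colours a and one further colour C number at most 3m': they are C-neighbours
-- of x, C-neighbours of y, or common a-neighbours of x and y.
--   * k = 2: every vertex is x, y, or such a vertex, so n ≤ 2 + 3m' = 3m - 1.
--   * k ≥ 3: if a is a colour of the Gallai-partition, every vertex lies in
--     the part of x, the part of y (at most m' vertices each), or sees x and y
--     in a and the other partition colour, so n ≤ 5m' = 5m - 5.  Otherwise
--     every vertex lies in the part of x or is a neighbour of x in one of the
--     two (inadmissible) partition colours, so n ≤ 3m' ≤ 5m'.

open import Defs hiding (sym)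
open import Data.Nat using (ℕ; zero; suc; _+_; _*_; _≤_; _∸_; z≤n; s≤s)
open import Data.Nat.Properties
  using (≤-trans; ≤-reflexive; ≤-pred; ≰⇒>; _≤?_; +-suc; +-monoʳ-≤; +-mono-≤; n≤1+n; m≤n+m; *-suc)
open import Data.Nat.Tactic.RingSolver using (solve-∀)
open import Data.Fin using (Fin; zero; suc)
open import Data.Fin.Properties using (suc-injective; _≟_)
open import Data.Product using (Σ; _×_; _,_; proj₁; proj₂)
open import Data.Sum using (_⊎_; inj₁; inj₂; map₁; map₂; swap)
open import Function using (_∘_)
open import Function.Definitions using (Injective)
open import Relation.Nullary using (¬_; Dec; yes; no; contradiction)
open import Relation.Nullary.Decidable using (_×-dec_; _⊎-dec_; ¬?)
open import Relation.Binary.PropositionalEquality using (_≡_; _≢_; refl; sym; trans; cong; subst)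

-- "at most s elements of Fin n satisfy P"; a record rather than a bare
-- inequality so that P? can be inferred from a bound
record AtMost {n : ℕ} {P : Fin n → Set} (P? : ∀ x → Dec (P x)) (s : ℕ) : Set where
  constructor atMost
  field count≤ : count P P? ≤ s

_∪?_ : ∀ {n} {P Q : Fin n → Set} → (∀ x → Dec (P x)) → (∀ x → Dec (Q x)) → ∀ x → Dec (P x ⊎ Q x)
(P? ∪? Q?) x = P? x ⊎-dec Q? x

count-mono : ∀ {n} {P Q : Fin n → Set} (P? : ∀ x → Dec (P x)) (Q? : ∀ x → Dec (Q x)) →
  (∀ x → P x → Q x) → count P P? ≤ count Q Q?
count-mono {zero} _ _ _ = z≤n
count-mono {suc n} P? Q? P⊆Q with P? zero | Q? zero
... | yes _ | yes _ = s≤s (count-mono (P? ∘ suc) (Q? ∘ suc) (P⊆Q ∘ suc))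
... | yes p | no ¬q = contradiction (P⊆Q zero p) ¬q
... | no _  | yes _ = ≤-trans (count-mono (P? ∘ suc) (Q? ∘ suc) (P⊆Q ∘ suc)) (n≤1+n _)
... | no _  | no _  = count-mono (P? ∘ suc) (Q? ∘ suc) (P⊆Q ∘ suc)

count-∪ : ∀ {n} {P Q : Fin n → Set} (P? : ∀ x → Dec (P x)) (Q? : ∀ x → Dec (Q x)) →
  count (λ x → P x ⊎ Q x) (P? ∪? Q?) ≤ count P P? + count Q Q?
count-∪ {zero} _ _ = z≤n
count-∪ {suc n} P? Q? with P? zero | Q? zero
... | yes _ | yes _ = s≤s (≤-trans (count-∪ (P? ∘ suc) (Q? ∘ suc)) (+-monoʳ-≤ _ (n≤1+n _)))
... | yes _ | no _  = s≤s (count-∪ (P? ∘ suc) (Q? ∘ suc))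
... | no _  | yes _ = ≤-trans (s≤s (count-∪ (P? ∘ suc) (Q? ∘ suc))) (≤-reflexive (sym (+-suc _ _)))
... | no _  | no _  = count-∪ (P? ∘ suc) (Q? ∘ suc)

atMost-∪ : ∀ {n} {P Q : Fin n → Set} {P? : ∀ x → Dec (P x)} {Q? : ∀ x → Dec (Q x)} {s t} →
  AtMost P? s → AtMost Q? t → AtMost (P? ∪? Q?) (s + t)
atMost-∪ {P? = P?} {Q? = Q?} (atMost P≤s) (atMost Q≤t) =
  atMost (≤-trans (count-∪ P? Q?) (+-mono-≤ P≤s Q≤t))

count-all : ∀ {n} {P : Fin n → Set} (P? : ∀ x → Dec (P x)) → (∀ x → P x) → n ≤ count P P?
count-all {zero} _ _ = z≤n
count-all {suc n} P? all with P? zero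
... | yes _ = s≤s (count-all (P? ∘ suc) (all ∘ suc))
... | no ¬p = contradiction (all zero) ¬p

covered : ∀ {n} {P : Fin n → Set} {P? : ∀ x → Dec (P x)} {s} → (∀ x → P x) → AtMost P? s → n ≤ s
covered {P? = P?} all (atMost P≤s) = ≤-trans (count-all P? all) P≤s

count-none : ∀ {n} {P : Fin n → Set} (P? : ∀ x → Dec (P x)) → (∀ x → ¬ P x) → count P P? ≡ 0
count-none {zero} _ _ = refl
count-none {suc n} P? none with P? zero
... | yes p = contradiction p (none zero)
... | no _ = count-none (P? ∘ suc) (none ∘ suc)

count-unique : ∀ {n} {P : Fin n → Set} (P? : ∀ x → Dec (P x)) → (∀ x y → P x → P y → x ≡ y) →
  count P P? ≤ 1
count-unique {zero} _ _ = z≤n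
count-unique {suc n} P? unique with P? zero
... | yes p = s≤s (≤-reflexive (count-none (P? ∘ suc) (λ x q → zero≢suc (unique zero (suc x) p q))))
  where zero≢suc : ∀ {x : Fin n} → zero ≢ suc x
        zero≢suc ()
... | no _ = count-unique (P? ∘ suc) (λ x y p q → suc-injective (unique (suc x) (suc y) p q))

singleton : ∀ {n} (u : Fin n) → AtMost (_≟ u) 1
singleton u = atMost (count-unique (_≟ u) (λ _ _ p q → trans p (sym q)))

choose : ∀ {n} {P : Fin n → Set} (P? : ∀ x → Dec (P x)) (m : ℕ) → m ≤ count P P? →
  Σ (Fin m → Fin n) λ w → Injective _≡_ _≡_ w × (∀ t → P (w t))
choose _ zero _ = (λ ()) , (λ {s} → λ _ → noFin s) , (λ ())
  where noFin : ∀ {A : Set} → Fin 0 → A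
        noFin ()
choose {zero} _ (suc m) ()
choose {suc n} P? (suc m) m<count with P? zero
... | no _ with choose (P? ∘ suc) (suc m) m<count
...   | w , w-inj , w-ok = (λ t → suc (w t)) , (λ e → w-inj (suc-injective e)) , w-ok
choose {suc n} {P} P? (suc m) m<count | yes p with choose (P? ∘ suc) m (≤-pred m<count)
...   | w , w-inj , w-ok = w' , w'-inj , w'-ok
  where
    w' : Fin (suc m) → Fin (suc n)
    w' zero = zero
    w' (suc t) = suc (w t)
    w'-inj : Injective _≡_ _≡_ w'
    w'-inj {zero}  {zero}  _ = refl
    w'-inj {suc s} {suc t} e = cong suc (w-inj (suc-injective e))
    w'-ok : ∀ t → P (w' t)
    w'-ok zero = p
    w'-ok (suc t) = w-ok t

other : Fin 2 → Fin 2
other zero = suc zero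
other (suc zero) = zero

fin2-split : ∀ (a b : Fin 2) → b ≡ a ⊎ b ≡ other a
fin2-split zero zero = inj₁ refl
fin2-split zero (suc zero) = inj₂ refl
fin2-split (suc zero) zero = inj₂ refl
fin2-split (suc zero) (suc zero) = inj₁ refl

module UniqueAdmissible {n k : ℕ} (c : Colouring n k) (m' : ℕ)
       (noBook : ¬ MonoBook c (suc m')) (one : ExactlyOneAdmissible c (suc m')) where

  a : Fin k
  a = proj₁ one

  inadmissible : ∀ C → C ≢ a → ∀ v → colDeg c C v ≤ m'
  inadmissible C C≢a v with suc m' ≤? colDeg c C v
  ... | yes m≤deg = contradiction (proj₂ (proj₂ one) C (v , m≤deg)) C≢a
  ... | no m≰deg = ≤-pred (≰⇒> m≰deg)

  -- a vertex of a-degree ≥ m has an a-coloured edge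
  spine : Σ (Fin n) λ x → Σ (Fin n) λ y → (x ≢ y) × (col c x y ≡ a)
  spine with proj₁ (proj₂ one)
  ... | x , m≤deg with choose _ 1 (≤-trans (s≤s z≤n) m≤deg)
  ...   | w , _ , w-ok = x , w zero , w-ok zero

  OffNbr : Fin k → Fin n → Fin n → Set
  OffNbr C u z = (C ≢ a) × (u ≢ z) × (col c u z ≡ C)

  offNbr? : ∀ C u z → Dec (OffNbr C u z)
  offNbr? C u z = ¬? (C ≟ a) ×-dec ¬? (u ≟ z) ×-dec (col c u z ≟ C)

  offNbr-bound : ∀ C u → AtMost (offNbr? C u) m'
  offNbr-bound C u = atMost (byColour (C ≟ a))
    where
      byColour : Dec (C ≡ a) → count (OffNbr C u) (offNbr? C u) ≤ m'
      byColour (yes C≡a) = ≤-trans (≤-reflexive (count-none (offNbr? C u) (λ _ off → proj₁ off C≡a))) z≤n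
      byColour (no C≢a) = ≤-trans (count-mono (offNbr? C u) _ (λ _ → proj₂)) (inadmissible C C≢a u)

  CommonNbr : Fin n → Fin n → Fin n → Set
  CommonNbr u v z = (z ≢ u) × (z ≢ v) × (col c u z ≡ a) × (col c v z ≡ a)

  commonNbr? : ∀ u v z → Dec (CommonNbr u v z)
  commonNbr? u v z = ¬? (z ≟ u) ×-dec ¬? (z ≟ v) ×-dec (col c u z ≟ a) ×-dec (col c v z ≟ a)

  -- m common a-neighbours of an a-edge would form a monochromatic B_m
  commonNbr-bound : ∀ {u v} → u ≢ v → col c u v ≡ a → AtMost (commonNbr? u v) m'
  commonNbr-bound {u} {v} u≢v uv≡a with suc m' ≤? count (CommonNbr u v) (commonNbr? u v)
  ... | no m≰count = atMost (≤-pred (≰⇒> m≰count))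
  ... | yes m≤count with choose _ (suc m') m≤count
  ...   | w , w-inj , w-ok = contradiction book noBook
    where
      book : MonoBook c (suc m')
      book = a , u , v , w , u≢v , w-inj , (λ t → proj₁ (w-ok t)) , (λ t → proj₁ (proj₂ (w-ok t))) ,
             uv≡a , (λ t → proj₁ (proj₂ (proj₂ (w-ok t)))) , (λ t → proj₂ (proj₂ (proj₂ (w-ok t))))

  InColours : Fin k → Fin k → Set
  InColours C b = (b ≡ a) ⊎ (b ≡ C)

  TwoColoured : Fin k → Fin n → Fin n → Fin n → Set
  TwoColoured C u v z = (z ≢ u) × (z ≢ v) × InColours C (col c u z) × InColours C (col c v z)

  twoColoured-split : ∀ {C u v z} → TwoColoured C u v z →
                      OffNbr C u z ⊎ OffNbr C v z ⊎ CommonNbr u v z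
  twoColoured-split {C} (z≢u , z≢v , uz , vz) with C ≟ a
  ... | yes C≡a = inj₂ (inj₂ (z≢u , z≢v , toA uz , toA vz))
    where toA : ∀ {b} → InColours C b → b ≡ a
          toA (inj₁ b≡a) = b≡a
          toA (inj₂ b≡C) = trans b≡C C≡a
  ... | no C≢a with uz | vz
  ...   | inj₂ uz≡C | _         = inj₁ (C≢a , (λ e → z≢u (sym e)) , uz≡C)
  ...   | inj₁ _    | inj₂ vz≡C = inj₂ (inj₁ (C≢a , (λ e → z≢v (sym e)) , vz≡C))
  ...   | inj₁ uz≡a | inj₁ vz≡a = inj₂ (inj₂ (z≢u , z≢v , uz≡a , vz≡a))

  spine-bound : ∀ C {u v} → u ≢ v → col c u v ≡ a →
    {Su Sv : Fin n → Set} {Su? : ∀ z → Dec (Su z)} {Sv? : ∀ z → Dec (Sv z)} {s : ℕ} →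
    AtMost Su? s → AtMost Sv? s → (∀ z → Su z ⊎ Sv z ⊎ TwoColoured C u v z) →
    n ≤ s + (s + (m' + (m' + m')))
  spine-bound C {u} {v} u≢v uv≡a {Su} {Sv} Su≤s Sv≤s cover =
    covered refine
      (atMost-∪ Su≤s (atMost-∪ Sv≤s
        (atMost-∪ (offNbr-bound C u) (atMost-∪ (offNbr-bound C v) (commonNbr-bound u≢v uv≡a)))))
    where
      refine : ∀ z → Su z ⊎ Sv z ⊎ OffNbr C u z ⊎ OffNbr C v z ⊎ CommonNbr u v z
      refine z with cover z
      ... | inj₁ su = inj₁ su
      ... | inj₂ (inj₁ sv) = inj₂ (inj₁ sv)
      ... | inj₂ (inj₂ two) = inj₂ (inj₂ (twoColoured-split two))

  x y : Fin n
  x = proj₁ spine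
  y = proj₁ (proj₂ spine)

  x≢y : x ≢ y
  x≢y = proj₁ (proj₂ (proj₂ spine))

  xy≡a : col c x y ≡ a
  xy≡a = proj₂ (proj₂ (proj₂ spine))

  twoColours-bound : ∀ C → (∀ b → InColours C b) → n ≤ 1 + (1 + (m' + (m' + m')))
  twoColours-bound C onlyTwo =
    spine-bound C x≢y xy≡a (singleton x) (singleton y) cover
    where
      cover : ∀ z → z ≡ x ⊎ z ≡ y ⊎ TwoColoured C x y z
      cover z with z ≟ x | z ≟ y
      ... | yes z≡x | _ = inj₁ z≡x
      ... | no _ | yes z≡y = inj₂ (inj₁ z≡y)
      ... | no z≢x | no z≢y = inj₂ (inj₂ (z≢x , z≢y , onlyTwo _ , onlyTwo _))

  module _ (G : GallaiPartition c) (small : PartsAtMost c G m') where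
    open GallaiPartition G

    partOf : ∀ u → AtMost (λ z → part z ≟ part u) m'
    partOf u = atMost (small (part u))

    crossTwoColoured-bound : ∀ C → (∀ u z → part u ≢ part z → InColours C (col c u z)) →
                             n ≤ m' + (m' + (m' + (m' + m')))
    crossTwoColoured-bound C cross =
      spine-bound C x≢y xy≡a (partOf x) (partOf y) cover
      where
        cover : ∀ z → part z ≡ part x ⊎ part z ≡ part y ⊎ TwoColoured C x y z
        cover z with part z ≟ part x | part z ≟ part y
        ... | yes zx | _ = inj₁ zx
        ... | no _ | yes zy = inj₂ (inj₁ zy)
        ... | no zx | no zy = inj₂ (inj₂ ((λ e → zx (cong part e)) , (λ e → zy (cong part e)) ,
                                          cross x z (λ e → zx (sym e)) , cross y z (λ e → zy (sym e))))

    -- if a is not a partition colour, x has at most 2m' neighbours outside its part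
    crossOff-bound : colA ≢ a → colB ≢ a → n ≤ m' + (m' + m')
    crossOff-bound A≢a B≢a =
      covered cover (atMost-∪ (partOf x) (atMost-∪ (offNbr-bound colA x) (offNbr-bound colB x)))
      where
        cover : ∀ z → part z ≡ part x ⊎ OffNbr colA x z ⊎ OffNbr colB x z
        cover z with part z ≟ part x
        ... | yes zx = inj₁ zx
        ... | no zx with twoCols x z (λ e → zx (sym e))
        ...   | inj₁ xz≡A = inj₂ (inj₁ (A≢a , (λ e → zx (cong part (sym e))) , xz≡A))
        ...   | inj₂ xz≡B = inj₂ (inj₂ (B≢a , (λ e → zx (cong part (sym e))) , xz≡B))

    gallai-bound : n ≤ m' + (m' + (m' + (m' + m')))
    gallai-bound with colA ≟ a | colB ≟ a
    ... | yes A≡a | _ = crossTwoColoured-bound colB λ u z uz →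
            map₁ (λ e → trans e A≡a) (twoCols u z uz)
    ... | no _ | yes B≡a = crossTwoColoured-bound colA λ u z uz →
            swap (map₂ (λ e → trans e B≡a) (twoCols u z uz))
    ... | no A≢a | no B≢a = ≤-trans (crossOff-bound A≢a B≢a) (≤-trans (m≤n+m _ m') (m≤n+m _ m'))

three-bound : ∀ m' → 1 + (1 + (m' + (m' + m'))) ≡ 3 * suc m' ∸ 1
three-bound m' = trans (expand m') (sym (cong (_∸ 1) (*-suc 3 m')))
  where expand : ∀ m' → 1 + (1 + (m' + (m' + m'))) ≡ 2 + 3 * m'
        expand = solve-∀

five-bound : ∀ m' → m' + (m' + (m' + (m' + m'))) ≡ 5 * suc m' ∸ 5
five-bound m' = trans (expand m') (sym (cong (_∸ 5) (*-suc 5 m')))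
  where expand : ∀ m' → m' + (m' + (m' + (m' + m'))) ≡ 5 * m'
        expand = solve-∀

lemma4p2 : (m k n : ℕ) → 2 ≤ m → 2 ≤ k → (c : Colouring n k) →
    ¬ RainbowTriangle c → ¬ MonoBook c m →
    Σ (GallaiPartition c) (λ P → PartsAtMost c P (m ∸ 1)) →
    ExactlyOneAdmissible c m →
    n ≤ bound k m
lemma4p2 (suc m') 2 n _ _ c _ noBook _ one =
  subst (n ≤_) (three-bound m') (twoColours-bound (other a) (fin2-split a))
  where open UniqueAdmissible c m' noBook one
lemma4p2 (suc m') (suc (suc (suc _))) n _ _ c _ noBook (G , small) one =
  subst (n ≤_) (five-bound m') (gallai-bound G small)
  where open UniqueAdmissible c m' noBook one
lemma4p2 (suc _) 1 _ _ (s≤s ()) _ _ _ _ _
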